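{- Let $\Gamma=(V,E,o,t)$ be a connected finite graph with finite modulus $\rho\colon I\to V$. There is an exact sequence $0\to\mathbb{Z}\xrightarrow{1\mapsto\sum_{i\in I}i}\mathbb{Z}[I]\to\mathrm{J}_{\mathfrak m}(\Gamma)\to\mathrm{J}(\Gamma)\to0$, in which the surjection is induced by the transpose $\mathcal{H}^1(\Gamma_{\mathfrak m})^\vee\to\mathcal{H}^1(\Gamma)^\vee$ of the extension-by-zero inclusion $j_!\colon\mathcal{H}^1(\Gamma)\hookrightarrow\mathcal{H}^1(\Gamma_{\mathfrak m})$, $\omega\mapsto(\omega,0)$.
   Context: Graph: $V\ne\emptyset$, $E$, $o,t\colon E\to V$; finite, connected. Modulus: nonempty finite family $(w_i)_{i\in I}$, $\rho(i)=w_i$, $I(v)=\rho^{ -1}(v)$. $\partial=t-o\colon\mathbb{Z}[E]\to\mathbb{Z}[V]$, $H_1(\Gamma)=\ker\partial$; $d^*\colon\mathbb{Z}^E\to\mathbb{Z}^V$, $(d^*\omega)(v)=\sum_{t(e)=v}\omega(e)-\sum_{o(e)=v}\omega(e)$; $\mathcal{H}^1(\Gamma)=\ker d^*$. Extended graph $\Gamma_{\mathfrak m}$: add vertex $\star$ and edges $e_i$ ($i\in I$) with $o(e_i)=\star$, $t(e_i)=w_i$; $C^1(\Gamma_{\mathfrak m})=\mathbb{Z}^E\oplus\mathbb{Z}^I$ and $\mathcal{H}^1(\Gamma_{\mathfrak m})=\ker d^*_{\mathfrak m}$ where $d^*_{\mathfrak m}(f,g)=(d^*f+r^*g,-\sum_ig(i))$,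 $(r^*g)(v)=\sum_{i\in I(v)}g(i)$. $M^\vee=\mathrm{Hom}(M,\mathbb{Z})$. $\alpha\colon H_1(\Gamma)\to\mathcal{H}^1(\Gamma)^\vee$, $\gamma\mapsto(\omega\mapsto\omega(\gamma))$; $\mathrm{J}(\Gamma)=\mathcal{H}^1(\Gamma)^\vee/\alpha(H_1(\Gamma))$. $\alpha_{\mathfrak m}\colon H_1(\Gamma)\to\mathcal{H}^1(\Gamma_{\mathfrak m})^\vee$, $\gamma\mapsto((f,g)\mapsto f(\gamma))$; $\mathrm{J}_{\mathfrak m}(\Gamma)=\mathcal{H}^1(\Gamma_{\mathfrak m})^\vee/\alpha_{\mathfrak m}(H_1(\Gamma))$. -}

module Defs where

open import Data.Nat using (ℕ; zero; suc)
open import Data.Fin using (Fin; zero; suc; _≟_)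
open import Data.Integer using (ℤ; _+_; _-_; _*_; -_; 0ℤ; 1ℤ)
open import Data.Integer.Properties using (+-identityʳ; +-assoc; +-comm)
open import Data.Bool using (if_then_else_; true; false)
open import Data.Product using (Σ; _×_; _,_; proj₁; proj₂)
open import Relation.Nullary using (does)
open import Relation.Binary.PropositionalEquality
  using (_≡_; refl; cong; cong₂; sym; trans; module ≡-Reasoning)

sumFin : ∀ {n} → (Fin n → ℤ) → ℤ
sumFin {zero}  f = 0ℤ
sumFin {suc n} f = f zero + sumFin (λ i → f (suc i))

sumFin-zero : ∀ {n} → sumFin {n} (λ _ → 0ℤ) ≡ 0ℤ
sumFin-zero {zero}  = refl
sumFin-zero {suc n} = cong (0ℤ +_) (sumFin-zero {n})

sumFin-cong : ∀ {n} {f g : Fin n → ℤ} → (∀ i → f i ≡ g i) → sumFin f ≡ sumFin g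
sumFin-cong {zero}  h = refl
sumFin-cong {suc n} h = cong₂ _+_ (h zero) (sumFin-cong (λ i → h (suc i)))

δ : ∀ {n} → Fin n → Fin n → ℤ → ℤ
δ a v x = if does (a ≟ v) then x else 0ℤ

δ-zero : ∀ {n} (a v : Fin n) → δ a v 0ℤ ≡ 0ℤ
δ-zero a v with does (a ≟ v)
... | true  = refl
... | false = refl

-- indicator of the basis vector [a] ∈ ℤ[V], evaluated at v
χ : ∀ {n} → Fin n → Fin n → ℤ
χ a v = δ a v 1ℤ

_≗ᶻ_ : ∀ {n} → (Fin n → ℤ) → (Fin n → ℤ) → Set
f ≗ᶻ g = ∀ i → f i ≡ g i

_+ᶠ_ : ∀ {n} → (Fin n → ℤ) → (Fin n → ℤ) → (Fin n → ℤ)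
(f +ᶠ g) i = f i + g i

0ᶠ : ∀ {n} → Fin n → ℤ
0ᶠ _ = 0ℤ

record Graph : Set where
  field
    nV nE : ℕ
    o t   : Fin nE → Fin nV

open Graph public

data Reach (G : Graph) : Fin (nV G) → Fin (nV G) → Set where
  here : ∀ v → Reach G v v
  fwd  : ∀ e {w} → Reach G (t G e) w → Reach G (o G e) w
  bwd  : ∀ e {w} → Reach G (o G e) w → Reach G (t G e) w

Connected : Graph → Set
Connected G = ∀ u v → Reach G u v

∂ : (G : Graph) → (Fin (nE G) → ℤ) → Fin (nV G) → ℤ
∂ G γ v = sumFin (λ e → γ e * (χ (t G e) v - χ (o G e) v))

d* : (G : Graph) → (Fin (nE G) → ℤ) → Fin (nV G) → ℤ
d* G ω v = sumFin (λ e → δ (t G e) v (ω e)) - sumFin (λ e → δ (o G e) v (ω e))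

IsCycle : (G : Graph) → (Fin (nE G) → ℤ) → Set
IsCycle G γ = ∀ v → ∂ G γ v ≡ 0ℤ

IsCocycle : (G : Graph) → (Fin (nE G) → ℤ) → Set
IsCocycle G ω = ∀ v → d* G ω v ≡ 0ℤ

pairing : ∀ {n} → (Fin n → ℤ) → (Fin n → ℤ) → ℤ
pairing ω γ = sumFin (λ e → ω e * γ e)

record Modulus (G : Graph) : Set where
  field
    nI : ℕ
    ρ  : Fin nI → Fin (nV G)

open Modulus public

r* : {G : Graph} (m : Modulus G) → (Fin (nI m) → ℤ) → Fin (nV G) → ℤ
r* m g v = sumFin (λ i → δ (ρ m i) v (g i))

C¹ₘ : {G : Graph} → Modulus G → Set
C¹ₘ {G} m = (Fin (nE G) → ℤ) × (Fin (nI m) → ℤ)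

_≈ₘ_ : {G : Graph} {m : Modulus G} → C¹ₘ m → C¹ₘ m → Set
(f , g) ≈ₘ (f' , g') = (f ≗ᶻ f') × (g ≗ᶻ g')

_⊕ₘ_ : {G : Graph} {m : Modulus G} → C¹ₘ m → C¹ₘ m → C¹ₘ m
(f , g) ⊕ₘ (f' , g') = (f +ᶠ f') , (g +ᶠ g')

IsCocycleₘ : (G : Graph) (m : Modulus G) → C¹ₘ m → Set
IsCocycleₘ G m (f , g) = (∀ v → d* G f v + r* m g v ≡ 0ℤ) × (- sumFin g ≡ 0ℤ)

-- Dual M^∨ = Hom(M, ℤ) of a subgroup M = {x ∈ A | P x} of an abelian group A

record Dual (A : Set) (_≈_ : A → A → Set) (_⊕_ : A → A → A) (P : A → Set) : Set where
  field
    app      : (x : A) → P x → ℤ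
    app-ext  : ∀ x y (px : P x) (py : P y) → x ≈ y → app x px ≡ app y py
    additive : ∀ x y (px : P x) (py : P y) (pxy : P (x ⊕ y)) →
               app (x ⊕ y) pxy ≡ app x px + app y py

open Dual public

H¹∨ : Graph → Set
H¹∨ G = Dual (Fin (nE G) → ℤ) _≗ᶻ_ _+ᶠ_ (IsCocycle G)

H¹ₘ∨ : (G : Graph) → Modulus G → Set
H¹ₘ∨ G m = Dual (C¹ₘ m) (_≈ₘ_ {G} {m}) (_⊕ₘ_ {G} {m}) (IsCocycleₘ G m)

interchange : ∀ a b c d → (a + b) + (c + d) ≡ (a + c) + (b + d)
interchange a b c d = begin
  (a + b) + (c + d)  ≡⟨ +-assoc a b (c + d) ⟩
  a + (b + (c + d))  ≡⟨ cong (a +_) (sym (+-assoc b c d)) ⟩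
  a + ((b + c) + d)  ≡⟨ cong (λ z → a + (z + d)) (+-comm b c) ⟩
  a + ((c + b) + d)  ≡⟨ cong (a +_) (+-assoc c b d) ⟩
  a + (c + (b + d))  ≡⟨ sym (+-assoc a c (b + d)) ⟩
  (a + c) + (b + d)  ∎
  where open ≡-Reasoning

0∨ : ∀ {A : Set} {≈ : A → A → Set} {⊕ : A → A → A} {P : A → Set} → Dual A ≈ ⊕ P
app      0∨ _ _ = 0ℤ
app-ext  0∨ _ _ _ _ _ = refl
additive 0∨ _ _ _ _ _ = refl

_+∨_ : ∀ {A : Set} {≈ : A → A → Set} {⊕ : A → A → A} {P : A → Set} → Dual A ≈ ⊕ P → Dual A ≈ ⊕ P → Dual A ≈ ⊕ P
app      (φ +∨ ψ) x p = app φ x p + app ψ x p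
app-ext  (φ +∨ ψ) x y px py e = cong₂ _+_ (app-ext φ x y px py e) (app-ext ψ x y px py e)
additive (φ +∨ ψ) x y px py pxy =
  trans (cong₂ _+_ (additive φ x y px py pxy) (additive ψ x y px py pxy))
        (interchange (app φ x px) (app φ y py) (app ψ x px) (app ψ y py))

-- J(Γ) = 𝓗¹(Γ)^∨ / α(H₁(Γ)), as the setoid (H¹∨ G , _∼J_)

J-rel : (G : Graph) → H¹∨ G → H¹∨ G → Set
J-rel G φ ψ = Σ (Fin (nE G) → ℤ) λ γ → IsCycle G γ ×
  (∀ ω (p : IsCocycle G ω) → app φ ω p - app ψ ω p ≡ pairing ω γ)

-- J_m(Γ) = 𝓗¹(Γ_m)^∨ / α_m(H₁(Γ)), as the setoid (H¹ₘ∨ G m , _∼Jₘ_)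
Jₘ-rel : (G : Graph) (m : Modulus G) → H¹ₘ∨ G m → H¹ₘ∨ G m → Set
Jₘ-rel G m φ ψ = Σ (Fin (nE G) → ℤ) λ γ → IsCycle G γ ×
  (∀ f g (p : IsCocycleₘ G m (f , g)) → app φ (f , g) p - app ψ (f , g) p ≡ pairing f γ)

j! : {G : Graph} (m : Modulus G) → (Fin (nE G) → ℤ) → C¹ₘ m
j! m ω = ω , 0ᶠ

r*-zero : {G : Graph} (m : Modulus G) (v : Fin (nV G)) → r* m 0ᶠ v ≡ 0ℤ
r*-zero m v = trans (sumFin-cong (λ i → δ-zero (ρ m i) v)) (sumFin-zero {nI m})

j!-cocycle : (G : Graph) (m : Modulus G) (ω : Fin (nE G) → ℤ) →
             IsCocycle G ω → IsCocycleₘ G m (j! m ω)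
j!-cocycle G m ω p =
  (λ v → trans (cong (d* G ω v +_) (r*-zero m v)) (trans (+-identityʳ _) (p v))) ,
  cong -_ (sumFin-zero {nI m})

j!∨ : {G : Graph} (m : Modulus G) → H¹ₘ∨ G m → H¹∨ G
app      (j!∨ {G} m φ) ω p = app φ (j! m ω) (j!-cocycle G m ω p)
app-ext  (j!∨ {G} m φ) x y px py e =
  app-ext φ (j! m x) (j! m y) (j!-cocycle G m x px) (j!-cocycle G m y py) (e , λ _ → refl)
additive (j!∨ {G} m φ) x y px py pxy =
  trans (app-ext φ (j! m (x +ᶠ y)) (_⊕ₘ_ {G} {m} (j! m x) (j! m y))
                   (j!-cocycle G m (x +ᶠ y) pxy) pxy' (( λ _ → refl) , λ _ → refl))
        (additive φ (j! m x) (j! m y) (j!-cocycle G m x px) (j!-cocycle G m y py) pxy')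
  where
    pxy' : IsCocycleₘ G m (_⊕ₘ_ {G} {m} (j! m x) (j! m y))
    pxy' = (λ v → trans (cong (d* G (x +ᶠ y) v +_) (r*-zero m v))
                        (trans (+-identityʳ _) (pxy v))) ,
           cong -_ (sumFin-zero {nI m})

-- ℤ → ℤ[I],  1 ↦ Σ_{i ∈ I} i
ιI : ∀ {n} → ℤ → Fin n → ℤ
ιI k _ = k

module Submission where

-- Fix i₀ ∈ I and, for each i ∈ I, a path in Γ from ρ(i) to ρ(i₀); its 1-cochain route i has
-- d*(route i) = [ρ i₀] − [ρ i], so εᵢ = (route i, [i] − [i₀]) is a cocycle of Γ_m.  Every cocycle
-- (f, g) of Γ_m, for which Σᵢ gᵢ = 0, decomposes as j_!(f − Σᵢ gᵢ route i) + Σᵢ gᵢ εᵢ.  Hence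
-- 𝓗¹(Γ_m) = j_! 𝓗¹(Γ) ⊕ ⟨εᵢ⟩ with ⟨εᵢ⟩ ≅ {g ∈ ℤ^I | Σ g = 0}, and dually
-- 𝓗¹(Γ_m)^∨ ≅ 𝓗¹(Γ)^∨ ⊕ ℤ[I]/ℤ·Σᵢ i, from which the sequence is read off after dividing by H₁(Γ).
-- The one place where H₁(Γ) interferes is injectivity of ℤ[I]/ℤ·Σᵢ i → J_m(Γ): if a ∈ ℤ[I] maps
-- to α_m(γ), restricting to j_! gives ω(γ) = 0 for all ω ∈ 𝓗¹(Γ).  Since d* and ∂ are given by the
-- same incidence numbers, γ is itself in 𝓗¹(Γ), so Σₑ γₑ² = γ(γ) = 0 and γ = 0.

open import Defs
open import Data.Nat using (_≤_)
import Data.Nat as ℕ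
open import Data.Fin using (Fin; zero; suc; _≟_; fromℕ<)
open import Data.Integer using (ℤ; 0ℤ; 1ℤ; -1ℤ; +_; -[1+_]; _+_; _-_; _*_; -_)
import Data.Integer as ℤ
open import Data.Integer.Properties
  using ( +-identityˡ; +-identityʳ; +-inverseˡ; +-inverseʳ; +-minus-telescope; +-mono-≤; +-monoʳ-≤
        ; *-identityʳ; *-zeroˡ; *-zeroʳ; *-assoc; *-comm; *-distribʳ-+; *-distribˡ-+; suc-*
        ; neg-injective; neg-distribˡ-*; -1*i≡-i; i-j≡0⇒i≡j; i*j≡0⇒i≡0∨j≡0; +◃n≡+n
        ; ≤-refl; ≤-antisym; +-*-semiring; +-*-ring )
open import Data.Integer.Tactic.RingSolver using (solve-∀)
open import Algebra.Properties.Ring +-*-ring using (x+x≈x⇒x≈0; +-inverseˡ-unique; [y-z]x≈yx-zx)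
import Algebra.Properties.Semiring.Sum +-*-semiring as Sum
open import Data.Bool using (true; false)
open import Data.Product using (Σ; _×_; _,_; proj₁; proj₂)
open import Data.Sum using (reduce)
open import Function using (_∘_)
open import Function.Bundles using (_⇔_; mk⇔)
open import Relation.Nullary using (does)
open import Relation.Binary.PropositionalEquality
  using (_≡_; refl; sym; trans; cong; cong₂; subst; subst₂; module ≡-Reasoning)

open ≡-Reasoning

-- Finite sums and the standard pairing on ℤ^n

sumFin≡sum : ∀ {n} (f : Fin n → ℤ) → sumFin f ≡ Sum.sum f
sumFin≡sum {ℕ.zero}  f = refl
sumFin≡sum {ℕ.suc n} f = cong (_+_ (f zero)) (sumFin≡sum (f ∘ suc))

sumFin-+ : ∀ {n} (f g : Fin n → ℤ) → sumFin (f +ᶠ g) ≡ sumFin f + sumFin g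
sumFin-+ f g = begin
  sumFin (f +ᶠ g)        ≡⟨ sumFin≡sum (f +ᶠ g) ⟩
  Sum.sum (f +ᶠ g)       ≡⟨ Sum.∑-distrib-+ f g ⟩
  Sum.sum f + Sum.sum g  ≡⟨ sym (cong₂ _+_ (sumFin≡sum f) (sumFin≡sum g)) ⟩
  sumFin f + sumFin g    ∎

sumFin-*ˡ : ∀ {n} (k : ℤ) (f : Fin n → ℤ) → sumFin (λ i → k * f i) ≡ k * sumFin f
sumFin-*ˡ k f = begin
  sumFin (λ i → k * f i)   ≡⟨ sumFin≡sum (λ i → k * f i) ⟩
  Sum.sum (λ i → k * f i)  ≡⟨ sym (Sum.*-distribˡ-sum k f) ⟩
  k * Sum.sum f            ≡⟨ cong (k *_) (sym (sumFin≡sum f)) ⟩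
  k * sumFin f             ∎

sumFin-comm : ∀ {m n} (h : Fin m → Fin n → ℤ) →
  sumFin (λ i → sumFin (h i)) ≡ sumFin (λ j → sumFin (λ i → h i j))
sumFin-comm h = begin
  sumFin (λ i → sumFin (h i))                ≡⟨ sumFin-cong (λ i → sumFin≡sum (h i)) ⟩
  sumFin (λ i → Sum.sum (h i))               ≡⟨ sumFin≡sum (λ i → Sum.sum (h i)) ⟩
  Sum.sum (λ i → Sum.sum (h i))              ≡⟨ Sum.∑-comm h ⟩
  Sum.sum (λ j → Sum.sum (λ i → h i j))      ≡⟨ sym (sumFin≡sum (λ j → Sum.sum (λ i → h i j))) ⟩
  sumFin (λ j → Sum.sum (λ i → h i j))       ≡⟨ sym (sumFin-cong (λ j → sumFin≡sum (λ i → h i j))) ⟩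
  sumFin (λ j → sumFin (λ i → h i j))        ∎

infixl 6 _-ᶠ_
_-ᶠ_ : ∀ {n} → (Fin n → ℤ) → (Fin n → ℤ) → Fin n → ℤ
(f -ᶠ g) i = f i - g i

infixl 7 _·ᶠ_
_·ᶠ_ : ∀ {n} → ℤ → (Fin n → ℤ) → Fin n → ℤ
(k ·ᶠ f) i = k * f i

sumFin-0ᶠ : ∀ {n} {f : Fin n → ℤ} → f ≗ᶻ 0ᶠ → sumFin f ≡ 0ℤ
sumFin-0ᶠ {n} f≗0 = trans (sumFin-cong f≗0) (sumFin-zero {n})

sumFin-neg : ∀ {n} (f : Fin n → ℤ) → sumFin (λ i → - f i) ≡ - sumFin f
sumFin-neg f = begin
  sumFin (λ i → - f i)      ≡⟨ sumFin-cong (λ i → sym (-1*i≡-i (f i))) ⟩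
  sumFin (λ i → -1ℤ * f i)  ≡⟨ sumFin-*ˡ -1ℤ f ⟩
  -1ℤ * sumFin f            ≡⟨ -1*i≡-i (sumFin f) ⟩
  - sumFin f                ∎

sumFin-- : ∀ {n} (f g : Fin n → ℤ) → sumFin (f -ᶠ g) ≡ sumFin f - sumFin g
sumFin-- f g = trans (sumFin-+ f (λ i → - g i)) (cong (_+_ (sumFin f)) (sumFin-neg g))

χ-sym : ∀ {n} (i j : Fin n) → χ i j ≡ χ j i
χ-sym zero    zero    = refl
χ-sym zero    (suc j) = refl
χ-sym (suc i) zero    = refl
χ-sym (suc i) (suc j) = χ-sym i j

δ≡*χ : ∀ {n} (a v : Fin n) (x : ℤ) → δ a v x ≡ x * χ a v
δ≡*χ a v x with does (a ≟ v)
... | true  = sym (*-identityʳ x)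
... | false = sym (*-zeroʳ x)

sumFin-χ : ∀ {n} (i : Fin n) → sumFin (χ i) ≡ 1ℤ
sumFin-χ {ℕ.suc n} zero    = cong (_+_ 1ℤ) (sumFin-zero {n})
sumFin-χ           (suc i) = trans (+-identityˡ _) (sumFin-χ i)

pairing-comm : ∀ {n} (f w : Fin n → ℤ) → pairing f w ≡ pairing w f
pairing-comm f w = sumFin-cong (λ e → *-comm (f e) (w e))

pairing-0ʳ : ∀ {n} (f : Fin n → ℤ) → pairing f 0ᶠ ≡ 0ℤ
pairing-0ʳ f = sumFin-0ᶠ (λ e → *-zeroʳ (f e))

pairing-0ˡ : ∀ {n} (w : Fin n → ℤ) → pairing 0ᶠ w ≡ 0ℤ
pairing-0ˡ w = trans (pairing-comm 0ᶠ w) (pairing-0ʳ w)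

pairing-congʳ : ∀ {n} (f : Fin n → ℤ) {w w' : Fin n → ℤ} → w ≗ᶻ w' → pairing f w ≡ pairing f w'
pairing-congʳ f w≗w' = sumFin-cong (λ e → cong (f e *_) (w≗w' e))

pairing-congˡ : ∀ {n} {f f' : Fin n → ℤ} (w : Fin n → ℤ) → f ≗ᶻ f' → pairing f w ≡ pairing f' w
pairing-congˡ w f≗f' = sumFin-cong (λ e → cong (_* w e) (f≗f' e))

pairing-+ˡ : ∀ {n} (f f' w : Fin n → ℤ) → pairing (f +ᶠ f') w ≡ pairing f w + pairing f' w
pairing-+ˡ f f' w = trans (sumFin-cong (λ e → *-distribʳ-+ (w e) (f e) (f' e)))
                          (sumFin-+ (λ e → f e * w e) (λ e → f' e * w e))

pairing-+ʳ : ∀ {n} (f w w' : Fin n → ℤ) → pairing f (w +ᶠ w') ≡ pairing f w + pairing f w'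
pairing-+ʳ f w w' = begin
  pairing f (w +ᶠ w')          ≡⟨ pairing-comm f (w +ᶠ w') ⟩
  pairing (w +ᶠ w') f          ≡⟨ pairing-+ˡ w w' f ⟩
  pairing w f + pairing w' f   ≡⟨ cong₂ _+_ (pairing-comm w f) (pairing-comm w' f) ⟩
  pairing f w + pairing f w'   ∎

pairing--ˡ : ∀ {n} (f f' w : Fin n → ℤ) → pairing (f -ᶠ f') w ≡ pairing f w - pairing f' w
pairing--ˡ f f' w = trans (sumFin-cong (λ e → [y-z]x≈yx-zx (w e) (f e) (f' e)))
                          (sumFin-- (λ e → f e * w e) (λ e → f' e * w e))

pairing--ʳ : ∀ {n} (f w w' : Fin n → ℤ) → pairing f (w -ᶠ w') ≡ pairing f w - pairing f w'
pairing--ʳ f w w' = begin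
  pairing f (w -ᶠ w')          ≡⟨ pairing-comm f (w -ᶠ w') ⟩
  pairing (w -ᶠ w') f          ≡⟨ pairing--ˡ w w' f ⟩
  pairing w f - pairing w' f   ≡⟨ cong₂ _-_ (pairing-comm w f) (pairing-comm w' f) ⟩
  pairing f w - pairing f w'   ∎

pairing-·ˡ : ∀ {n} (k : ℤ) (f w : Fin n → ℤ) → pairing (k ·ᶠ f) w ≡ k * pairing f w
pairing-·ˡ k f w = trans (sumFin-cong (λ e → *-assoc k (f e) (w e)))
                         (sumFin-*ˡ k (λ e → f e * w e))

pairing-·ʳ : ∀ {n} (k : ℤ) (f w : Fin n → ℤ) → pairing f (k ·ᶠ w) ≡ k * pairing f w
pairing-·ʳ k f w = begin
  pairing f (k ·ᶠ w)  ≡⟨ pairing-comm f (k ·ᶠ w) ⟩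
  pairing (k ·ᶠ w) f  ≡⟨ pairing-·ˡ k w f ⟩
  k * pairing w f     ≡⟨ cong (k *_) (pairing-comm w f) ⟩
  k * pairing f w     ∎

pairing-const≡0 : ∀ {n} (f : Fin n → ℤ) (c : ℤ) → sumFin f ≡ 0ℤ → pairing f (λ _ → c) ≡ 0ℤ
pairing-const≡0 f c Σf≡0 = begin
  pairing f (λ _ → c)  ≡⟨ sumFin-cong (λ e → *-comm (f e) c) ⟩
  sumFin (c ·ᶠ f)      ≡⟨ sumFin-*ˡ c f ⟩
  c * sumFin f         ≡⟨ cong (c *_) Σf≡0 ⟩
  c * 0ℤ               ≡⟨ *-zeroʳ c ⟩
  0ℤ                   ∎

pairing-χʳ : ∀ {n} (w : Fin n → ℤ) (i : Fin n) → pairing w (χ i) ≡ w i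
pairing-χʳ w zero = begin
  w zero * 1ℤ + pairing (w ∘ suc) 0ᶠ  ≡⟨ cong₂ _+_ (*-identityʳ (w zero)) (pairing-0ʳ (w ∘ suc)) ⟩
  w zero + 0ℤ                         ≡⟨ +-identityʳ (w zero) ⟩
  w zero                              ∎
pairing-χʳ w (suc i) = begin
  w zero * 0ℤ + pairing (w ∘ suc) (χ i)  ≡⟨ cong (_+ pairing (w ∘ suc) (χ i)) (*-zeroʳ (w zero)) ⟩
  0ℤ + pairing (w ∘ suc) (χ i)           ≡⟨ +-identityˡ _ ⟩
  pairing (w ∘ suc) (χ i)                ≡⟨ pairing-χʳ (w ∘ suc) i ⟩
  w (suc i)                              ∎

pairing-χˡ : ∀ {n} (i : Fin n) (w : Fin n → ℤ) → pairing (χ i) w ≡ w i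
pairing-χˡ i w = trans (pairing-comm (χ i) w) (pairing-χʳ w i)

lincomb : ∀ {n k} → (Fin n → ℤ) → (Fin n → Fin k → ℤ) → Fin k → ℤ
lincomb g h e = pairing g (λ i → h i e)

pairing-lincombˡ : ∀ {n k} (g : Fin n → ℤ) (h : Fin n → Fin k → ℤ) (w : Fin k → ℤ) →
  pairing (lincomb g h) w ≡ pairing g (λ i → pairing (h i) w)
pairing-lincombˡ g h w = begin
  sumFin (λ e → lincomb g h e * w e)
    ≡⟨ sumFin-cong (λ e → trans (*-comm (lincomb g h e) (w e))
                                (sym (sumFin-*ˡ (w e) (λ i → g i * h i e)))) ⟩
  sumFin (λ e → sumFin (λ i → w e * (g i * h i e)))
    ≡⟨ sumFin-comm (λ e i → w e * (g i * h i e)) ⟩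
  sumFin (λ i → sumFin (λ e → w e * (g i * h i e)))
    ≡⟨ sumFin-cong (λ i → trans (sumFin-cong (λ e → rotate (w e) (g i) (h i e)))
                                (sumFin-*ˡ (g i) (λ e → h i e * w e))) ⟩
  sumFin (λ i → g i * pairing (h i) w)
    ∎
  where
  rotate : ∀ a b c → a * (b * c) ≡ b * (c * a)
  rotate = solve-∀

square-nonneg : ∀ x → 0ℤ ℤ.≤ x * x
square-nonneg (+ n)    = subst (0ℤ ℤ.≤_) (sym (+◃n≡+n (n ℕ.* n))) (ℤ.+≤+ ℕ.z≤n)
square-nonneg -[1+ n ] = subst (0ℤ ℤ.≤_) (sym (+◃n≡+n (ℕ.suc n ℕ.* ℕ.suc n))) (ℤ.+≤+ ℕ.z≤n)

square≡0⇒≡0 : ∀ x → x * x ≡ 0ℤ → x ≡ 0ℤ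
square≡0⇒≡0 x x*x≡0 = reduce (i*j≡0⇒i≡0∨j≡0 x x*x≡0)

nonneg-+≡0⇒≡0 : ∀ {a b} → 0ℤ ℤ.≤ a → 0ℤ ℤ.≤ b → a + b ≡ 0ℤ → a ≡ 0ℤ × b ≡ 0ℤ
nonneg-+≡0⇒≡0 {a} {b} 0≤a 0≤b a+b≡0 =
  ≤-antisym (subst₂ ℤ._≤_ (+-identityʳ a) a+b≡0 (+-monoʳ-≤ a 0≤b)) 0≤a ,
  ≤-antisym (subst₂ ℤ._≤_ (+-identityˡ b) a+b≡0 (+-mono-≤ 0≤a ≤-refl)) 0≤b

pairing-self-nonneg : ∀ {n} (f : Fin n → ℤ) → 0ℤ ℤ.≤ pairing f f
pairing-self-nonneg {ℕ.zero}  f = ≤-refl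
pairing-self-nonneg {ℕ.suc n} f = +-mono-≤ (square-nonneg (f zero)) (pairing-self-nonneg (f ∘ suc))

pairing-self≡0⇒≗0ᶠ : ∀ {n} (f : Fin n → ℤ) → pairing f f ≡ 0ℤ → f ≗ᶻ 0ᶠ
pairing-self≡0⇒≗0ᶠ {ℕ.suc n} f ff≡0 i
  with nonneg-+≡0⇒≡0 (square-nonneg (f zero)) (pairing-self-nonneg (f ∘ suc)) ff≡0
pairing-self≡0⇒≗0ᶠ f ff≡0 zero    | f₀²≡0 , _ = square≡0⇒≡0 (f zero) f₀²≡0
pairing-self≡0⇒≗0ᶠ f ff≡0 (suc i) | _ , rest≡0 = pairing-self≡0⇒≗0ᶠ (f ∘ suc) rest≡0 i

-- Graphs

incidence : (G : Graph) → Fin (nV G) → Fin (nE G) → ℤ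
incidence G v e = χ (t G e) v - χ (o G e) v

d*≡∂ : (G : Graph) (f : Fin (nE G) → ℤ) (v : Fin (nV G)) → d* G f v ≡ ∂ G f v
d*≡∂ G f v = begin
  d* G f v
    ≡⟨ cong₂ _-_ (sumFin-cong (λ e → δ≡*χ (t G e) v (f e)))
                 (sumFin-cong (λ e → δ≡*χ (o G e) v (f e))) ⟩
  pairing f (λ e → χ (t G e) v) - pairing f (λ e → χ (o G e) v)
    ≡⟨ sym (pairing--ʳ f (λ e → χ (t G e) v) (λ e → χ (o G e) v)) ⟩
  ∂ G f v
    ∎

cycle⇒cocycle : (G : Graph) {γ : Fin (nE G) → ℤ} → IsCycle G γ → IsCocycle G γ
cycle⇒cocycle G {γ} ∂γ≡0 v = trans (d*≡∂ G γ v) (∂γ≡0 v)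

0ᶠ-cycle : (G : Graph) → IsCycle G 0ᶠ
0ᶠ-cycle G v = pairing-0ˡ (incidence G v)

·ᶠ-cycle : (G : Graph) (k : ℤ) {γ : Fin (nE G) → ℤ} → IsCycle G γ → IsCycle G (k ·ᶠ γ)
·ᶠ-cycle G k {γ} ∂γ≡0 v = begin
  ∂ G (k ·ᶠ γ) v  ≡⟨ pairing-·ˡ k γ (incidence G v) ⟩
  k * ∂ G γ v     ≡⟨ cong (k *_) (∂γ≡0 v) ⟩
  k * 0ℤ          ≡⟨ *-zeroʳ k ⟩
  0ℤ              ∎

+ᶠ-cocycle : (G : Graph) {f f' : Fin (nE G) → ℤ} →
  IsCocycle G f → IsCocycle G f' → IsCocycle G (f +ᶠ f')
+ᶠ-cocycle G {f} {f'} d*f≡0 d*f'≡0 v = begin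
  d* G (f +ᶠ f') v        ≡⟨ d*≡∂ G (f +ᶠ f') v ⟩
  ∂ G (f +ᶠ f') v         ≡⟨ pairing-+ˡ f f' (incidence G v) ⟩
  ∂ G f v + ∂ G f' v      ≡⟨ sym (cong₂ _+_ (d*≡∂ G f v) (d*≡∂ G f' v)) ⟩
  d* G f v + d* G f' v    ≡⟨ cong₂ _+_ (d*f≡0 v) (d*f'≡0 v) ⟩
  0ℤ                      ∎

pathCochain : (G : Graph) {u w : Fin (nV G)} → Reach G u w → Fin (nE G) → ℤ
pathCochain G (here v)  = 0ᶠ
pathCochain G (fwd e r) = pathCochain G r +ᶠ χ e
pathCochain G (bwd e r) = pathCochain G r -ᶠ χ e

∂-pathCochain : (G : Graph) {u w : Fin (nV G)} (r : Reach G u w) (v : Fin (nV G)) →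
  ∂ G (pathCochain G r) v ≡ χ w v - χ u v
∂-pathCochain G (here w) v = trans (pairing-0ˡ (incidence G v)) (sym (+-inverseʳ (χ w v)))
∂-pathCochain G (fwd e {w} r) v = begin
  ∂ G (pathCochain G r +ᶠ χ e) v
    ≡⟨ pairing-+ˡ (pathCochain G r) (χ e) (incidence G v) ⟩
  ∂ G (pathCochain G r) v + ∂ G (χ e) v
    ≡⟨ cong₂ _+_ (∂-pathCochain G r v) (pairing-χˡ e (incidence G v)) ⟩
  (χ w v - χ (t G e) v) + incidence G v e
    ≡⟨ +-minus-telescope (χ w v) (χ (t G e) v) (χ (o G e) v) ⟩
  χ w v - χ (o G e) v
    ∎
∂-pathCochain G (bwd e {w} r) v = begin
  ∂ G (pathCochain G r -ᶠ χ e) v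
    ≡⟨ pairing--ˡ (pathCochain G r) (χ e) (incidence G v) ⟩
  ∂ G (pathCochain G r) v - ∂ G (χ e) v
    ≡⟨ cong₂ _-_ (∂-pathCochain G r v) (pairing-χˡ e (incidence G v)) ⟩
  (χ w v - χ (o G e) v) - incidence G v e
    ≡⟨ cancel-right (χ w v) (χ (t G e) v) (χ (o G e) v) ⟩
  χ w v - χ (t G e) v
    ∎
  where
  cancel-right : ∀ a b c → (a - c) - (b - c) ≡ a - b
  cancel-right = solve-∀

α-injective : (G : Graph) {γ : Fin (nE G) → ℤ} → IsCycle G γ →
  (∀ ω → IsCocycle G ω → pairing ω γ ≡ 0ℤ) → γ ≗ᶻ 0ᶠ
α-injective G {γ} γ-cycle α[γ]≡0 = pairing-self≡0⇒≗0ᶠ γ (α[γ]≡0 γ (cycle⇒cocycle G γ-cycle))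

≗⇒J-rel : (G : Graph) {x y : H¹∨ G} → (∀ ω p → app x ω p ≡ app y ω p) → J-rel G x y
≗⇒J-rel G {x} {y} x≗y = 0ᶠ , 0ᶠ-cycle G , λ ω p →
  trans (cong (_- app y ω p) (x≗y ω p)) (trans (+-inverseʳ (app y ω p)) (sym (pairing-0ʳ ω)))

-- Cochains of the extended graph Γ_m

module Cochainsₘ {G : Graph} (m : Modulus G) where

  infixl 6 _⊕_
  _⊕_ : C¹ₘ m → C¹ₘ m → C¹ₘ m
  _⊕_ = _⊕ₘ_ {G} {m}

  infixl 7 _·ₘ_
  _·ₘ_ : ℤ → C¹ₘ m → C¹ₘ m
  k ·ₘ c = k ·ᶠ proj₁ c , k ·ᶠ proj₂ c

  0ₘ : C¹ₘ m
  0ₘ = 0ᶠ , 0ᶠ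

  lincombₘ : ∀ {n} → (Fin n → ℤ) → (Fin n → C¹ₘ m) → C¹ₘ m
  lincombₘ g c = lincomb g (proj₁ ∘ c) , lincomb g (proj₂ ∘ c)

  fiber : Fin (nV G) → Fin (nI m) → ℤ
  fiber v i = χ (ρ m i) v

  r*≡pairing : (g : Fin (nI m) → ℤ) (v : Fin (nV G)) → r* m g v ≡ pairing g (fiber v)
  r*≡pairing g v = sumFin-cong (λ i → δ≡*χ (ρ m i) v (g i))

  IsCocycleₘ-intro : {f : Fin (nE G) → ℤ} {g : Fin (nI m) → ℤ} →
    (∀ v → ∂ G f v + pairing g (fiber v) ≡ 0ℤ) → sumFin g ≡ 0ℤ → IsCocycleₘ G m (f , g)
  IsCocycleₘ-intro {f} {g} balanced Σg≡0 =
    (λ v → trans (cong₂ _+_ (d*≡∂ G f v) (r*≡pairing g v)) (balanced v)) , cong -_ Σg≡0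

  IsCocycleₘ-∂ : {f : Fin (nE G) → ℤ} {g : Fin (nI m) → ℤ} → IsCocycleₘ G m (f , g) →
    ∀ v → ∂ G f v + pairing g (fiber v) ≡ 0ℤ
  IsCocycleₘ-∂ {f} {g} (balanced , _) v =
    trans (sym (cong₂ _+_ (d*≡∂ G f v) (r*≡pairing g v))) (balanced v)

  IsCocycleₘ-Σ : {f : Fin (nE G) → ℤ} {g : Fin (nI m) → ℤ} → IsCocycleₘ G m (f , g) → sumFin g ≡ 0ℤ
  IsCocycleₘ-Σ (_ , -Σg≡0) = neg-injective {j = 0ℤ} -Σg≡0

  ⊕-cocycle : {c c' : C¹ₘ m} → IsCocycleₘ G m c → IsCocycleₘ G m c' → IsCocycleₘ G m (c ⊕ c')
  ⊕-cocycle {f , g} {f' , g'} p p' = IsCocycleₘ-intro balanced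
    (trans (sumFin-+ g g') (cong₂ _+_ (IsCocycleₘ-Σ p) (IsCocycleₘ-Σ p')))
    where
    balanced : ∀ v → ∂ G (f +ᶠ f') v + pairing (g +ᶠ g') (fiber v) ≡ 0ℤ
    balanced v = begin
      ∂ G (f +ᶠ f') v + pairing (g +ᶠ g') (fiber v)
        ≡⟨ cong₂ _+_ (pairing-+ˡ f f' (incidence G v)) (pairing-+ˡ g g' (fiber v)) ⟩
      (∂ G f v + ∂ G f' v) + (pairing g (fiber v) + pairing g' (fiber v))
        ≡⟨ interchange (∂ G f v) (∂ G f' v) (pairing g (fiber v)) (pairing g' (fiber v)) ⟩
      (∂ G f v + pairing g (fiber v)) + (∂ G f' v + pairing g' (fiber v))
        ≡⟨ cong₂ _+_ (IsCocycleₘ-∂ p v) (IsCocycleₘ-∂ p' v) ⟩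
      0ℤ
        ∎

  ·ₘ-cocycle : (k : ℤ) {c : C¹ₘ m} → IsCocycleₘ G m c → IsCocycleₘ G m (k ·ₘ c)
  ·ₘ-cocycle k {f , g} p = IsCocycleₘ-intro balanced
    (trans (sumFin-*ˡ k g) (trans (cong (k *_) (IsCocycleₘ-Σ p)) (*-zeroʳ k)))
    where
    balanced : ∀ v → ∂ G (k ·ᶠ f) v + pairing (k ·ᶠ g) (fiber v) ≡ 0ℤ
    balanced v = begin
      ∂ G (k ·ᶠ f) v + pairing (k ·ᶠ g) (fiber v)
        ≡⟨ cong₂ _+_ (pairing-·ˡ k f (incidence G v)) (pairing-·ˡ k g (fiber v)) ⟩
      k * ∂ G f v + k * pairing g (fiber v)
        ≡⟨ sym (*-distribˡ-+ k (∂ G f v) (pairing g (fiber v))) ⟩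
      k * (∂ G f v + pairing g (fiber v))
        ≡⟨ cong (k *_) (IsCocycleₘ-∂ p v) ⟩
      k * 0ℤ
        ≡⟨ *-zeroʳ k ⟩
      0ℤ
        ∎

  0ₘ-cocycle : IsCocycleₘ G m 0ₘ
  0ₘ-cocycle = j!-cocycle G m 0ᶠ (cycle⇒cocycle G (0ᶠ-cycle G))

  lincombₘ-cocycle : ∀ {n} (g : Fin n → ℤ) {c : Fin n → C¹ₘ m} →
    (∀ i → IsCocycleₘ G m (c i)) → IsCocycleₘ G m (lincombₘ g c)
  lincombₘ-cocycle {ℕ.zero}  g pc = 0ₘ-cocycle
  lincombₘ-cocycle {ℕ.suc n} g pc =
    ⊕-cocycle (·ₘ-cocycle (g zero) (pc zero)) (lincombₘ-cocycle (g ∘ suc) (pc ∘ suc))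

  module _ (x : H¹ₘ∨ G m) where

    app-0ₘ : (p : IsCocycleₘ G m 0ₘ) → app x 0ₘ p ≡ 0ℤ
    app-0ₘ p = x+x≈x⇒x≈0 (app x 0ₘ p) (sym (additive x 0ₘ 0ₘ p p p))

    app-+·ₘ : ∀ n {c} (pc : IsCocycleₘ G m c) (pnc : IsCocycleₘ G m (+ n ·ₘ c)) →
      app x (+ n ·ₘ c) pnc ≡ + n * app x c pc
    app-+·ₘ ℕ.zero {c} pc p0c = begin
      app x (+ 0 ·ₘ c) p0c  ≡⟨ app-ext x _ 0ₘ p0c 0ₘ-cocycle
                                 ((λ e → *-zeroˡ (proj₁ c e)) , (λ i → *-zeroˡ (proj₂ c i))) ⟩
      app x 0ₘ 0ₘ-cocycle   ≡⟨ app-0ₘ 0ₘ-cocycle ⟩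
      0ℤ                    ≡⟨ sym (*-zeroˡ (app x c pc)) ⟩
      + 0 * app x c pc      ∎
    app-+·ₘ (ℕ.suc n) {c} pc psc = begin
      app x (+ ℕ.suc n ·ₘ c) psc          ≡⟨ app-ext x _ (c ⊕ + n ·ₘ c) psc pc+nc unfold ⟩
      app x (c ⊕ + n ·ₘ c) pc+nc          ≡⟨ additive x c (+ n ·ₘ c) pc pnc pc+nc ⟩
      app x c pc + app x (+ n ·ₘ c) pnc   ≡⟨ cong (_+_ (app x c pc)) (app-+·ₘ n pc pnc) ⟩
      app x c pc + + n * app x c pc       ≡⟨ sym (suc-* (+ n) (app x c pc)) ⟩
      + ℕ.suc n * app x c pc              ∎
      where
      pnc = ·ₘ-cocycle (+ n) pc
      pc+nc = ⊕-cocycle pc pnc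
      unfold : _≈ₘ_ {G} {m} (+ ℕ.suc n ·ₘ c) (c ⊕ + n ·ₘ c)
      unfold = (λ e → suc-* (+ n) (proj₁ c e)) , (λ i → suc-* (+ n) (proj₂ c i))

    app-·ₘ : ∀ k {c} (pc : IsCocycleₘ G m c) (pkc : IsCocycleₘ G m (k ·ₘ c)) →
      app x (k ·ₘ c) pkc ≡ k * app x c pc
    app-·ₘ (+ n)    pc pnc = app-+·ₘ n pc pnc
    app-·ₘ -[1+ n ] {c} pc pkc = begin
      app x (-[1+ n ] ·ₘ c) pkc        ≡⟨ +-inverseˡ-unique _ _ opposite ⟩
      - app x (+ ℕ.suc n ·ₘ c) ppc     ≡⟨ cong -_ (app-+·ₘ (ℕ.suc n) pc ppc) ⟩
      - (+ ℕ.suc n * app x c pc)       ≡⟨ neg-distribˡ-* (+ ℕ.suc n) (app x c pc) ⟩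
      -[1+ n ] * app x c pc            ∎
      where
      ppc = ·ₘ-cocycle (+ ℕ.suc n) pc
      pkc+pc = ⊕-cocycle pkc ppc
      cancel : ∀ y → -[1+ n ] * y + + ℕ.suc n * y ≡ 0ℤ
      cancel y = trans (sym (*-distribʳ-+ y -[1+ n ] (+ ℕ.suc n)))
                       (trans (cong (_* y) (+-inverseˡ (+ ℕ.suc n))) (*-zeroˡ y))
      opposite : app x (-[1+ n ] ·ₘ c) pkc + app x (+ ℕ.suc n ·ₘ c) ppc ≡ 0ℤ
      opposite = begin
        app x (-[1+ n ] ·ₘ c) pkc + app x (+ ℕ.suc n ·ₘ c) ppc
          ≡⟨ sym (additive x _ _ pkc ppc pkc+pc) ⟩
        app x (-[1+ n ] ·ₘ c ⊕ + ℕ.suc n ·ₘ c) pkc+pc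
          ≡⟨ app-ext x _ 0ₘ pkc+pc 0ₘ-cocycle
               ((λ e → cancel (proj₁ c e)) , (λ i → cancel (proj₂ c i))) ⟩
        app x 0ₘ 0ₘ-cocycle
          ≡⟨ app-0ₘ 0ₘ-cocycle ⟩
        0ℤ
          ∎

    app-lincombₘ : ∀ {n} (g : Fin n → ℤ) {c : Fin n → C¹ₘ m} (pc : ∀ i → IsCocycleₘ G m (c i))
      (p : IsCocycleₘ G m (lincombₘ g c)) →
      app x (lincombₘ g c) p ≡ pairing g (λ i → app x (c i) (pc i))
    app-lincombₘ {ℕ.zero}  g pc p = app-0ₘ p
    app-lincombₘ {ℕ.suc n} g {c} pc p =
      trans (additive x (g zero ·ₘ c zero) (lincombₘ (g ∘ suc) (c ∘ suc)) p₀ p₊ p)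
            (cong₂ _+_ (app-·ₘ (g zero) (pc zero) p₀) (app-lincombₘ (g ∘ suc) (pc ∘ suc) p₊))
      where
      p₀ = ·ₘ-cocycle (g zero) (pc zero)
      p₊ = lincombₘ-cocycle (g ∘ suc) (pc ∘ suc)

  pairingᴵ : (Fin (nI m) → ℤ) → H¹ₘ∨ G m
  app      (pairingᴵ a) (f , g) _ = pairing g a
  app-ext  (pairingᴵ a) (f , g) (f' , g') _ _ (_ , g≗g') = pairing-congˡ a g≗g'
  additive (pairingᴵ a) (f , g) (f' , g') _ _ _ = pairing-+ˡ g g' a

  ≗⇒Jₘ-rel : {x y : H¹ₘ∨ G m} → (∀ f g p → app x (f , g) p ≡ app y (f , g) p) → Jₘ-rel G m x y
  ≗⇒Jₘ-rel {x} {y} x≗y = 0ᶠ , 0ᶠ-cycle G , λ f g p →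
    trans (cong (_- app y (f , g) p) (x≗y f g p))
          (trans (+-inverseʳ (app y (f , g) p)) (sym (pairing-0ʳ f)))

  pairingᴵ-cong : ∀ a b → a ≗ᶻ b → Jₘ-rel G m (pairingᴵ a) (pairingᴵ b)
  pairingᴵ-cong a b a≗b = ≗⇒Jₘ-rel {pairingᴵ a} {pairingᴵ b} (λ f g _ → pairing-congʳ g a≗b)

  pairingᴵ-+ : ∀ a b → Jₘ-rel G m (pairingᴵ (a +ᶠ b)) (pairingᴵ a +∨ pairingᴵ b)
  pairingᴵ-+ a b =
    ≗⇒Jₘ-rel {pairingᴵ (a +ᶠ b)} {pairingᴵ a +∨ pairingᴵ b} (λ f g _ → pairing-+ʳ g a b)

  j!∨-respects : ∀ x y → Jₘ-rel G m x y → J-rel G (j!∨ m x) (j!∨ m y)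
  j!∨-respects x y (γ , γ-cycle , x-y≡γ) =
    γ , γ-cycle , λ ω p → x-y≡γ ω 0ᶠ (j!-cocycle G m ω p)

ιI-injective : ∀ {n} → Fin n → ∀ k → ιI {n} k ≗ᶻ 0ᶠ → k ≡ 0ℤ
ιI-injective i₀ k k≗0 = k≗0 i₀

-- The splitting of 𝓗¹(Γ_m) along j_!

module Splitting {G : Graph} (conn : Connected G) (m : Modulus G) (i₀ : Fin (nI m)) where
  open Cochainsₘ m

  route : Fin (nI m) → Fin (nE G) → ℤ
  route i = pathCochain G (conn (ρ m i) (ρ m i₀))

  ∂-route : ∀ i v → ∂ G (route i) v ≡ fiber v i₀ - fiber v i
  ∂-route i = ∂-pathCochain G (conn (ρ m i) (ρ m i₀))

  ε : Fin (nI m) → C¹ₘ m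
  ε i = route i , χ i -ᶠ χ i₀

  ε-cocycle : ∀ i → IsCocycleₘ G m (ε i)
  ε-cocycle i = IsCocycleₘ-intro balanced
    (trans (sumFin-- (χ i) (χ i₀)) (cong₂ _-_ (sumFin-χ i) (sumFin-χ i₀)))
    where
    balanced : ∀ v → ∂ G (route i) v + pairing (χ i -ᶠ χ i₀) (fiber v) ≡ 0ℤ
    balanced v = begin
      ∂ G (route i) v + pairing (χ i -ᶠ χ i₀) (fiber v)
        ≡⟨ cong (_+_ (∂ G (route i) v)) (pairing--ˡ (χ i) (χ i₀) (fiber v)) ⟩
      ∂ G (route i) v + (pairing (χ i) (fiber v) - pairing (χ i₀) (fiber v))
        ≡⟨ cong₂ _+_ (∂-route i v) (cong₂ _-_ (pairing-χˡ i (fiber v)) (pairing-χˡ i₀ (fiber v))) ⟩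
      (fiber v i₀ - fiber v i) + (fiber v i - fiber v i₀)
        ≡⟨ +-minus-telescope (fiber v i₀) (fiber v i) (fiber v i₀) ⟩
      fiber v i₀ - fiber v i₀
        ≡⟨ +-inverseʳ (fiber v i₀) ⟩
      0ℤ
        ∎

  retract : (Fin (nE G) → ℤ) → (Fin (nI m) → ℤ) → Fin (nE G) → ℤ
  retract f g = f -ᶠ lincomb g route

  retract-cocycle : ∀ {f g} → IsCocycleₘ G m (f , g) → IsCocycle G (retract f g)
  retract-cocycle {f} {g} p v = begin
    d* G (retract f g) v
      ≡⟨ d*≡∂ G (retract f g) v ⟩
    ∂ G (retract f g) v
      ≡⟨ pairing--ˡ f (lincomb g route) (incidence G v) ⟩
    ∂ G f v - pairing (lincomb g route) (incidence G v)
      ≡⟨ cong (_-_ (∂ G f v)) ∂-lincomb ⟩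
    ∂ G f v - (0ℤ - pairing g (fiber v))
      ≡⟨ sub-neg (∂ G f v) (pairing g (fiber v)) ⟩
    ∂ G f v + pairing g (fiber v)
      ≡⟨ IsCocycleₘ-∂ p v ⟩
    0ℤ
      ∎
    where
    sub-neg : ∀ a b → a - (0ℤ - b) ≡ a + b
    sub-neg = solve-∀
    ∂-lincomb : pairing (lincomb g route) (incidence G v) ≡ 0ℤ - pairing g (fiber v)
    ∂-lincomb = begin
      pairing (lincomb g route) (incidence G v)
        ≡⟨ pairing-lincombˡ g route (incidence G v) ⟩
      pairing g (λ i → ∂ G (route i) v)
        ≡⟨ pairing-congʳ g (λ i → ∂-route i v) ⟩
      pairing g (λ i → fiber v i₀ - fiber v i)
        ≡⟨ pairing--ʳ g (λ _ → fiber v i₀) (fiber v) ⟩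
      pairing g (λ _ → fiber v i₀) - pairing g (fiber v)
        ≡⟨ cong (_- pairing g (fiber v)) (pairing-const≡0 g (fiber v i₀) (IsCocycleₘ-Σ p)) ⟩
      0ℤ - pairing g (fiber v)
        ∎

  retract-j! : ∀ ω → retract ω 0ᶠ ≗ᶻ ω
  retract-j! ω e = trans (cong (_-_ (ω e)) (pairing-0ˡ (λ i → route i e))) (+-identityʳ (ω e))

  decompose : ∀ {f g} → IsCocycleₘ G m (f , g) →
    _≈ₘ_ {G} {m} (f , g) (j! m (retract f g) ⊕ lincombₘ g ε)
  decompose {f} {g} p = edges , legs
    where
    sub-add : ∀ a b → a ≡ (a - b) + b
    sub-add = solve-∀
    edges : ∀ e → f e ≡ retract f g e + lincomb g route e
    edges e = sub-add (f e) (lincomb g route e)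
    legs : ∀ j → g j ≡ 0ℤ + lincomb g (proj₂ ∘ ε) j
    legs j = sym (begin
      0ℤ + pairing g (λ i → χ i j - χ i₀ j)
        ≡⟨ +-identityˡ _ ⟩
      pairing g (λ i → χ i j - χ i₀ j)
        ≡⟨ pairing--ʳ g (λ i → χ i j) (λ _ → χ i₀ j) ⟩
      pairing g (λ i → χ i j) - pairing g (λ _ → χ i₀ j)
        ≡⟨ cong₂ _-_ (trans (pairing-congʳ g (λ i → χ-sym i j)) (pairing-χʳ g j))
                     (pairing-const≡0 g (χ i₀ j) (IsCocycleₘ-Σ p)) ⟩
      g j - 0ℤ
        ≡⟨ +-identityʳ (g j) ⟩
      g j
        ∎)

  app-decompose : ∀ x {f g} (p : IsCocycleₘ G m (f , g)) →
    app x (f , g) p ≡ app (j!∨ m x) (retract f g) (retract-cocycle p)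
                      + pairing g (λ i → app x (ε i) (ε-cocycle i))
  app-decompose x {f} {g} p =
    trans (app-ext x _ _ p p-sum (decompose p))
          (trans (additive x _ _ p-j! p-ε p-sum)
                 (cong (_+_ (app x (j! m (retract f g)) p-j!)) (app-lincombₘ x g ε-cocycle p-ε)))
    where
    p-j!  = j!-cocycle G m (retract f g) (retract-cocycle p)
    p-ε   = lincombₘ-cocycle g ε-cocycle
    p-sum = ⊕-cocycle p-j! p-ε

  constants⊆ker-pairingᴵ : ∀ a → Σ ℤ (λ k → ιI k ≗ᶻ a) → Jₘ-rel G m (pairingᴵ a) 0∨
  constants⊆ker-pairingᴵ a (k , k≗a) = ≗⇒Jₘ-rel {pairingᴵ a} {0∨} λ f g p →
    trans (pairing-congʳ g (λ i → sym (k≗a i))) (pairing-const≡0 g k (IsCocycleₘ-Σ p))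

  ker-pairingᴵ⊆constants : ∀ a → Jₘ-rel G m (pairingᴵ a) 0∨ → Σ ℤ (λ k → ιI k ≗ᶻ a)
  ker-pairingᴵ⊆constants a (γ , γ-cycle , a≡γ) = a i₀ , λ i → sym (a-const i)
    where
    γ≗0 : γ ≗ᶻ 0ᶠ
    γ≗0 = α-injective G γ-cycle λ ω p →
      trans (sym (a≡γ ω 0ᶠ (j!-cocycle G m ω p))) (trans (+-identityʳ _) (pairing-0ˡ a))
    a-const : ∀ i → a i ≡ a i₀
    a-const i = i-j≡0⇒i≡j (a i) (a i₀) (begin
      a i - a i₀
        ≡⟨ sym (cong₂ _-_ (pairing-χˡ i a) (pairing-χˡ i₀ a)) ⟩
      pairing (χ i) a - pairing (χ i₀) a
        ≡⟨ sym (pairing--ˡ (χ i) (χ i₀) a) ⟩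
      pairing (χ i -ᶠ χ i₀) a
        ≡⟨ sym (+-identityʳ _) ⟩
      pairing (χ i -ᶠ χ i₀) a - 0ℤ
        ≡⟨ a≡γ (route i) (χ i -ᶠ χ i₀) (ε-cocycle i) ⟩
      pairing (route i) γ
        ≡⟨ trans (pairing-congʳ (route i) γ≗0) (pairing-0ʳ (route i)) ⟩
      0ℤ
        ∎)

  im-pairingᴵ⊆ker-j!∨ : ∀ x → Σ (Fin (nI m) → ℤ) (λ a → Jₘ-rel G m (pairingᴵ a) x) →
    J-rel G (j!∨ m x) 0∨
  im-pairingᴵ⊆ker-j!∨ x (a , γ , γ-cycle , a-x≡γ) =
    -1ℤ ·ᶠ γ , ·ᶠ-cycle G -1ℤ {γ} γ-cycle , λ ω p → begin
      app (j!∨ m x) ω p - 0ℤ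
        ≡⟨ negate-diff (app (j!∨ m x) ω p) ⟩
      -1ℤ * (0ℤ - app (j!∨ m x) ω p)
        ≡⟨ cong (λ z → -1ℤ * (z - app (j!∨ m x) ω p)) (sym (pairing-0ˡ a)) ⟩
      -1ℤ * (pairing 0ᶠ a - app (j!∨ m x) ω p)
        ≡⟨ cong (-1ℤ *_) (a-x≡γ ω 0ᶠ (j!-cocycle G m ω p)) ⟩
      -1ℤ * pairing ω γ
        ≡⟨ sym (pairing-·ʳ -1ℤ ω γ) ⟩
      pairing ω (-1ℤ ·ᶠ γ)
        ∎
    where
    negate-diff : ∀ b → b - 0ℤ ≡ -1ℤ * (0ℤ - b)
    negate-diff = solve-∀

  ker-j!∨⊆im-pairingᴵ : ∀ x → J-rel G (j!∨ m x) 0∨ →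
    Σ (Fin (nI m) → ℤ) (λ a → Jₘ-rel G m (pairingᴵ a) x)
  ker-j!∨⊆im-pairingᴵ x (γ , γ-cycle , x≡γ) =
    X -ᶠ R , -1ℤ ·ᶠ γ , ·ᶠ-cycle G -1ℤ {γ} γ-cycle , λ f g p → begin
      pairing g (X -ᶠ R) - app x (f , g) p
        ≡⟨ cong₂ _-_ (pairing--ʳ g X R) (app-decompose x p) ⟩
      (pairing g X - pairing g R) - (app (j!∨ m x) (retract f g) (retract-cocycle p) + pairing g X)
        ≡⟨ cong (λ z → (pairing g X - pairing g R) - (z + pairing g X)) (x-on-retract p) ⟩
      (pairing g X - pairing g R) - ((pairing f γ - pairing g R) + pairing g X)
        ≡⟨ collapse (pairing g X) (pairing g R) (pairing f γ) ⟩
      -1ℤ * pairing f γ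
        ≡⟨ sym (pairing-·ʳ -1ℤ f γ) ⟩
      pairing f (-1ℤ ·ᶠ γ)
        ∎
    where
    X R : Fin (nI m) → ℤ
    X i = app x (ε i) (ε-cocycle i)
    R i = pairing (route i) γ
    collapse : ∀ a b c → (a - b) - ((c - b) + a) ≡ -1ℤ * c
    collapse = solve-∀
    x-on-retract : ∀ {f g} (p : IsCocycleₘ G m (f , g)) →
      app (j!∨ m x) (retract f g) (retract-cocycle p) ≡ pairing f γ - pairing g R
    x-on-retract {f} {g} p = begin
      app (j!∨ m x) (retract f g) (retract-cocycle p)
        ≡⟨ sym (+-identityʳ _) ⟩
      app (j!∨ m x) (retract f g) (retract-cocycle p) - 0ℤ
        ≡⟨ x≡γ (retract f g) (retract-cocycle p) ⟩
      pairing (retract f g) γ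
        ≡⟨ pairing--ˡ f (lincomb g route) γ ⟩
      pairing f γ - pairing (lincomb g route) γ
        ≡⟨ cong (_-_ (pairing f γ)) (pairing-lincombˡ g route γ) ⟩
      pairing f γ - pairing g R
        ∎

  retract-+ : ∀ f f' g g' → retract (f +ᶠ f') (g +ᶠ g') ≗ᶻ (retract f g +ᶠ retract f' g')
  retract-+ f f' g g' e =
    trans (cong (_-_ (f e + f' e)) (pairing-+ˡ g g' (λ i → route i e)))
          (sub-interchange (f e) (f' e) (lincomb g route e) (lincomb g' route e))
    where
    sub-interchange : ∀ a b c d → (a + b) - (c + d) ≡ (a - c) + (b - d)
    sub-interchange = solve-∀

  j!∨-surjective : ∀ y → Σ (H¹ₘ∨ G m) (λ x → J-rel G (j!∨ m x) y)
  j!∨-surjective y = x , ≗⇒J-rel G {j!∨ m x} {y} λ ω p → app-ext y _ ω _ p (retract-j! ω)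
    where
    x : H¹ₘ∨ G m
    app x (f , g) p = app y (retract f g) (retract-cocycle p)
    app-ext x (f , g) (f' , g') p p' (f≗f' , g≗g') =
      app-ext y _ _ (retract-cocycle p) (retract-cocycle p')
        (λ e → cong₂ _-_ (f≗f' e) (pairing-congˡ (λ i → route i e) g≗g'))
    additive x (f , g) (f' , g') p p' p+p' =
      trans (app-ext y _ _ (retract-cocycle p+p') r+r' (retract-+ f f' g g'))
            (additive y _ _ (retract-cocycle p) (retract-cocycle p') r+r')
      where
      r+r' = +ᶠ-cocycle G (retract-cocycle p) (retract-cocycle p')

proposition3p3p2 : (G : Graph) → 1 ≤ nV G → Connected G →
  (m : Modulus G) → 1 ≤ nI m →
  Σ ((Fin (nI m) → ℤ) → H¹ₘ∨ G m) λ φ →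
    (∀ (a b : Fin (nI m) → ℤ) → a ≗ᶻ b → Jₘ-rel G m (φ a) (φ b)) ×
    (∀ (a b : Fin (nI m) → ℤ) → Jₘ-rel G m (φ (a +ᶠ b)) (φ a +∨ φ b)) ×
    (∀ (x y : H¹ₘ∨ G m) → Jₘ-rel G m x y → J-rel G (j!∨ m x) (j!∨ m y)) ×
    (∀ (k : ℤ) → ιI {nI m} k ≗ᶻ 0ᶠ → k ≡ 0ℤ) ×
    (∀ (a : Fin (nI m) → ℤ) →
      Jₘ-rel G m (φ a) 0∨ ⇔ Σ ℤ (λ k → ιI k ≗ᶻ a)) ×
    (∀ (x : H¹ₘ∨ G m) →
      J-rel G (j!∨ m x) 0∨ ⇔ Σ (Fin (nI m) → ℤ) (λ a → Jₘ-rel G m (φ a) x)) ×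
    (∀ (y : H¹∨ G) → Σ (H¹ₘ∨ G m) (λ x → J-rel G (j!∨ m x) y))
-- V ≠ ∅ is implied by I ≠ ∅.
proposition3p3p2 G _ conn m 1≤|I| =
  pairingᴵ , pairingᴵ-cong , pairingᴵ-+ , j!∨-respects ,
  ιI-injective i₀ ,
  (λ a → mk⇔ (ker-pairingᴵ⊆constants a) (constants⊆ker-pairingᴵ a)) ,
  (λ x → mk⇔ (ker-j!∨⊆im-pairingᴵ x) (im-pairingᴵ⊆ker-j!∨ x)) ,
  j!∨-surjective
  where
  i₀ = fromℕ< 1≤|I|
  open Cochainsₘ m
  open Splitting conn m i₀
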